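{- Let $m\in\mathbb N$. If $\Gamma\models^m M\triangleright P\sqsubseteq_{bis}N\triangleright Q$, then $\Gamma\models^m N\triangleright Q\sqsubseteq_{bis}M\triangleright P$.
   Context: Calculus. Fix disjoint countably infinite sets $\mathcal C$ of channel names ($c,d$) and $\mathcal V$ of variables ($x,y,z,w$); identifiers $u,v$ range over $\mathcal C\cup\mathcal V$. Processes: $P,Q::= u!\langle\vec v\rangle.P \mid u?(\vec x).P\mid \mathbf 0\mid \mathsf{if}\ u=v\ \mathsf{then}\ P\ \mathsf{else}\ Q\mid \mathsf{rec}\,w.P\mid w\mid P\parallel Q\mid \mathsf{alloc}\,x.P\mid \mathsf{free}\,u.P$; input binds $\vec x$, $\mathsf{rec}$ binds $w$, $\mathsf{alloc}$ binds $x$ (no name restriction). A resource environment $M$ is a set of (allocated) channels, infinitely many channels being unallocated; $M,c$ denotes $M\cup\{c\}$ and presupposes $c\notin M$. A system $M\triangleright P$ pairs a resource environment with a closed process. Types. Attributes $a::=\omega\mid 1\mid \bullet i$ ($i\in\mathbb N$; $\bullet$ abbreviates $\bullet 0$). Types $T::=U\mid \mathsf{proc}$, $U::=[\vec U]^a\mid \mu X.U\mid X$, closed contractive, up to equi-recursive equality $\sim$. Type environments $\Gamma$ are finite multisets of assumptions $u:T$. Splitting: $[\vec T]^\omega=[\vec T]^\omega\circ[\vec T]^\omega$; $\mathsf{proc}=\mathsf{proc}\circ\mathsf{proc}$; $[\vec T]^{\bullet i}=[\vec T]^{1}\circ[\vec T]^{\bullet(i+1)}$. Subtyping generated by $\bullet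 i\preceq\bullet(i+1)$, $\bullet i\preceq\omega$, $\omega\preceq 1$, lifted to $[\vec T]^{a_1}\preceq[\vec T]^{a_2}$. The relation $\prec$ on environments is the least reflexive transitive relation with: $\Gamma,u:T\prec\Gamma,u:T_1,u:T_2$ and its converse when $T=T_1\circ T_2$; $\Gamma,u:T_1\prec\Gamma,u:T_2$ when $T_1\sim T_2$ or $T_1\preceq T_2$; $\Gamma,u:T\prec\Gamma$; $\Gamma,u:[\vec T_1]^\bullet\prec\Gamma,u:[\vec T_2]^\bullet$. Decrement $(u:[\vec T]^a-1)$: empty if $a=1$; $u:[\vec T]^\omega$ if $a=\omega$; $u:[\vec T]^{\bullet i}$ if $a=\bullet(i+1)$; undefined if $a=\bullet$. Typing $\Gamma\vdash P$ is given by the rules: $\Gamma,(u:[\vec T]^a-1)\vdash P\Rightarrow\Gamma,u:[\vec T]^a,\vec v:\vec T\vdash u!\langle\vec v\rangle.P$; $\Gamma,(u:[\vec T]^a-1),\vec x:\vec T\vdash P\Rightarrow\Gamma,u:[\vec T]^a\vdash u?(\vec x).P$; $\Gamma_1\vdash P,\Gamma_2\vdash Q\Rightarrow\Gamma_1,\Gamma_2\vdash P\parallel Q$; $u,v\in\mathrm{dom}(\Gamma)$, $\Gamma\vdash P,\Gamma\vdash Q\Rightarrow\Gamma\vdash\mathsf{if}\ u=v\ \mathsf{then}\ P\ \mathsf{else}\ Q$; $\Gamma^\omega,w:\mathsf{proc}\vdash P\Rightarrow\Gamma^\omega\vdash\mathsf{rec}\,w.P$ ($\Gamma^\omega$ only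 unrestricted assumptions); $w:\mathsf{proc}\vdash w$; $\Gamma\vdash P\Rightarrow\Gamma,u:[\vec T]^\bullet\vdash\mathsf{free}\,u.P$; $\Gamma,x:[\vec T]^\bullet\vdash P\Rightarrow\Gamma\vdash\mathsf{alloc}\,x.P$; $\emptyset\vdash\mathbf 0$; $\Gamma'\vdash P,\Gamma\prec\Gamma'\Rightarrow\Gamma\vdash P$. $\Gamma$ is consistent if some $\Gamma'$ with each identifier occurring at most once satisfies $\Gamma'\prec\Gamma$. $\Gamma\vdash M\triangleright P$ iff $\Gamma\vdash P$, $\mathrm{dom}(\Gamma)\subseteq M$, $\Gamma$ consistent. A configuration $\Gamma\triangleleft M\triangleright P$: $\mathrm{dom}(\Gamma)\subseteq M$ and some $\Delta$ has $(\Gamma,\Delta)$ consistent and $\Delta\vdash M\triangleright P$. LTS. Pre-transitions $\Gamma\triangleleft M\triangleright P\xrightarrow{\mu}{}^{\mathrm{pre}}_k\Gamma'\triangleleft M'\triangleright P'$ ($\mu::=c!\vec d\mid c?\vec d\mid\tau\mid\mathsf{alloc}\mid\mathsf{free}\,c\mid\mathsf{env}$, $k\in\mathbb Z$) are the least relation with: $\Gamma,c:[\vec T]^a\triangleleft M\triangleright c!\langle\vec d\rangle.P\xrightarrow{c!\vec d}_0\Gamma,(c:[\vec T]^a-1),\vec d:\vec T\triangleleft M\triangleright P$; $\Gamma,c:[\vec T]^a,\vec d:\vec T\triangleleft M\triangleright c?(\vec x).P\xrightarrow{c?\vec d}_0\Gamma,(c:[\vec T]^a-1)\triangleleft M\triangleright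 P\{\vec d/\vec x\}$; if $\Gamma_1\triangleleft M\triangleright P\xrightarrow{c!\vec d}_0\Gamma_1'\triangleleft M\triangleright P'$ and $\Gamma_2\triangleleft M\triangleright Q\xrightarrow{c?\vec d}_0\Gamma_2'\triangleleft M\triangleright Q'$ then for any $\Gamma$, $\Gamma\triangleleft M\triangleright P\parallel Q\xrightarrow{\tau}_0\Gamma\triangleleft M\triangleright P'\parallel Q'$ (and symmetrically for $Q\parallel P$); parallel closure on either side preserving $\mu,k$ and the resulting environment; $\Gamma\triangleleft M\triangleright P\xrightarrow{\mathsf{env}}_0\Gamma'\triangleleft M\triangleright P$ when $\Gamma\prec\Gamma'$; cost-0 $\tau$-steps for recursion unfolding and for $\mathsf{if}\ c=c$ (to then-branch, $c\in M$) and $\mathsf{if}\ c=d$, $c\neq d$ (to else-branch, $c,d\in M$); $\Gamma\triangleleft M\triangleright\mathsf{alloc}\,x.P\xrightarrow{\tau}_{+1}\Gamma\triangleleft M,c\triangleright P\{c/x\}$; $\Gamma\triangleleft M\triangleright P\xrightarrow{\mathsf{alloc}}_{+1}\Gamma,c:[\vec T]^\bullet\triangleleft M,c\triangleright P$; $\Gamma\triangleleft M,c\triangleright\mathsf{free}\,c.P\xrightarrow{\tau}_{ -1}\Gamma\triangleleft M\triangleright P$; $\Gamma,c:[\vec T]^\bullet\triangleleft M,c\triangleright P\xrightarrow{\mathsf{free}\,c}_{ -1}\Gamma\triangleleft M\triangleright P$. A renaming modulo $\Gamma$, $\sigma_\Gamma$, is a bijection on channel names fixing every channel in $\mathrm{dom}(\Gamma)$.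 Transitions: $\Gamma\triangleleft M\triangleright P\xrightarrow{\mu}_kX$ iff $\Gamma\triangleleft(M\triangleright P)\sigma_\Gamma\xrightarrow{\mu}{}^{\mathrm{pre}}_kX$ for some renaming $\sigma_\Gamma$ modulo $\Gamma$. Weak transitions $\xRightarrow{\mu}_k$: zero or more $\tau$-transitions, one $\mu$-transition, zero or more $\tau$-transitions, $k$ the sum of costs; $\hat\mu=\mu$ if $\mu\neq\tau$, and $\xRightarrow{\hat\tau}_k$ denotes zero or more $\tau$-transitions with total cost $k$. Bisimulation. An amortised typed relation $\mathcal R$ is a set of quadruples $(\Gamma,n,S,T)$, $n\in\mathbb N$, $S,T$ systems with $\Gamma\triangleleft S$, $\Gamma\triangleleft T$ configurations; write $\Gamma\models S\,\mathcal R^n\,T$. It is an amortised typed bisimulation if whenever $\Gamma\models(M\triangleright P)\mathcal R^n(N\triangleright Q)$: every $\Gamma\triangleleft M\triangleright P\xrightarrow{\mu}_k\Gamma'\triangleleft M'\triangleright P'$ has some $\Gamma\triangleleft N\triangleright Q\xRightarrow{\hat\mu}_l\Gamma'\triangleleft N'\triangleright Q'$ with $\Gamma'\models(M'\triangleright P')\mathcal R^{n+l-k}(N'\triangleright Q')$; and every $\Gamma\triangleleft N\triangleright Q\xrightarrow{\mu}_l\Gamma'\triangleleft N'\triangleright Q'$ has some $\Gamma\triangleleft M\triangleright P\xRightarrow{\hat\mu}_k\Gamma'\triangleleft M'\triangleright P'$ with $\Gamma'\models(M'\triangleright P')\mathcal R^{n+l-k}(N'\triangleright Q')$ (credits must remain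 in $\mathbb N$). Bounded version: $\Gamma\models^m S\sqsubseteq_{bis}T$ means there exist $n\in\mathbb N$ and an amortised typed bisimulation $\mathcal R$ containing $(\Gamma,n,S,T)$ such that every credit appearing in a quadruple of $\mathcal R$ is at most $m$. -}

module Defs where

open import Data.Nat using (ℕ; zero; suc; _≤_; _≟_; _≡ᵇ_)
open import Data.Integer as ℤ using (ℤ; +_)
open import Data.Fin using (Fin; zero; suc; toℕ)
open import Data.Bool using (Bool; true; false; if_then_else_; _∨_)
open import Data.Maybe using (Maybe; just; nothing)
open import Data.List using (List; []; _∷_; _++_; map; zipWith; zip; length; filter)
open import Data.List.Relation.Unary.All using (All)
open import Data.List.Relation.Binary.Pointwise using (Pointwise)
open import Data.List.Relation.Binary.Permutation.Propositional using (_↭_)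
open import Data.List.Relation.Unary.Unique.Propositional using (Unique)
open import Data.List.Membership.Propositional using (_∈_)
open import Data.Product using (Σ; _×_; _,_; proj₁; proj₂; ∃)
open import Data.Unit using (⊤)
open import Data.Empty using (⊥)
open import Relation.Nullary using (¬_; ¬?)
open import Relation.Binary.PropositionalEquality using (_≡_; _≢_)
open import Function.Bundles using (_↔_; Inverse)

Chan : Set
Chan = ℕ

Var : Set
Var = ℕ

data Id : Set where
  ch : Chan → Id
  vr : Var → Id

-- Processes (named syntax; alloc / input / rec are binders)

data Proc : Set where
  out   : Id → List Id → Proc → Proc
  inp   : Id → List Var → Proc → Proc
  nil   : Proc
  ite   : Id → Id → Proc → Proc → Proc
  rec   : Var → Proc → Proc
  pvar  : Var → Proc
  par   : Proc → Proc → Proc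
  alloc : Var → Proc → Proc
  free  : Id → Proc → Proc

-- simultaneous substitution of channels for variables, P{d̃/x̃}
-- (substituted things are channel names, so no capture can occur)
VSub : Set
VSub = List (Var × Chan)

look : VSub → Var → Maybe Chan
look [] x = nothing
look ((y , c) ∷ s) x = if x ≡ᵇ y then just c else look s x

unbind : Var → VSub → VSub
unbind x s = filter (λ p → ¬? (proj₁ p ≟ x)) s

unbinds : List Var → VSub → VSub
unbinds [] s = s
unbinds (x ∷ xs) s = unbinds xs (unbind x s)

subId : VSub → Id → Id
subId s (ch c) = ch c
subId s (vr x) with look s x
... | just c  = ch c
... | nothing = vr x

subP : VSub → Proc → Proc
subP s (out u vs P)   = out (subId s u) (map (subId s) vs) (subP s P)
subP s (inp u xs P)   = inp (subId s u) xs (subP (unbinds xs s) P)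
subP s nil            = nil
subP s (ite u v P Q)  = ite (subId s u) (subId s v) (subP s P) (subP s Q)
subP s (rec w P)      = rec w (subP (unbind w s) P)
subP s (pvar w)       = pvar w
subP s (par P Q)      = par (subP s P) (subP s Q)
subP s (alloc x P)    = alloc x (subP (unbind x s) P)
subP s (free u P)     = free (subId s u) (subP s P)

memb : Var → List Var → Bool
memb w [] = false
memb w (x ∷ xs) = (w ≡ᵇ x) ∨ memb w xs

-- process substitution P{R/w} (used for unfolding rec w.P; R is closed)
psub : Var → Proc → Proc → Proc
psub w R (out u vs P)  = out u vs (psub w R P)
psub w R (inp u xs P)  = if memb w xs then inp u xs P else inp u xs (psub w R P)
psub w R nil           = nil
psub w R (ite u v P Q) = ite u v (psub w R P) (psub w R Q)
psub w R (rec w' P)    = if w ≡ᵇ w' then rec w' P else rec w' (psub w R P)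
psub w R (pvar w')     = if w ≡ᵇ w' then R else pvar w'
psub w R (par P Q)     = par (psub w R P) (psub w R Q)
psub w R (alloc x P)   = if w ≡ᵇ x then alloc x P else alloc x (psub w R P)
psub w R (free u P)    = free u (psub w R P)

renId : (Chan → Chan) → Id → Id
renId f (ch c) = ch (f c)
renId f (vr x) = vr x

renP : (Chan → Chan) → Proc → Proc
renP f (out u vs P)  = out (renId f u) (map (renId f) vs) (renP f P)
renP f (inp u xs P)  = inp (renId f u) xs (renP f P)
renP f nil           = nil
renP f (ite u v P Q) = ite (renId f u) (renId f v) (renP f P) (renP f Q)
renP f (rec w P)     = rec w (renP f P)
renP f (pvar w)      = pvar w
renP f (par P Q)     = par (renP f P) (renP f Q)
renP f (alloc x P)   = alloc x (renP f P)
renP f (free u P)    = free (renId f u) (renP f P)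

ResEnv : Set₁
ResEnv = Chan → Set

-- M , c   (used only when c ∉ M)
_,ₘ_ : ResEnv → Chan → ResEnv
(M ,ₘ c) d = (d ≡ c) Data.Sum.⊎ M d
  where import Data.Sum

_∖ₘ_ : ResEnv → Chan → ResEnv
(M ∖ₘ c) d = M d × d ≢ c

InfUnalloc : ResEnv → Set
InfUnalloc M = ∀ n → Σ Chan λ c → n ≤ c × ¬ M c

record Sys : Set₁ where
  constructor _▷_
  field
    res  : ResEnv
    proc : Proc

data Attr : Set where
  ω   : Attr
  one : Attr
  •_  : ℕ → Attr

data Ty (n : ℕ) : Set where
  chan : Attr → List (Ty n) → Ty n
  μ    : Ty (suc n) → Ty n
  tv   : Fin n → Ty n

-- contractiveness: no subterm μX₁…μXₖ.Xᵢ with Xᵢ bound in that chain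
ChainOK : ∀ {n} → ℕ → Ty n → Set
ChainOK d (chan a Ts) = ⊤
ChainOK d (μ U) = ChainOK (suc d) U
ChainOK d (tv i) = d ≤ toℕ i

mutual
  Contr : ∀ {n} → Ty n → Set
  Contr (chan a Ts) = Contrs Ts
  Contr (μ U) = ChainOK 1 U × Contr U
  Contr (tv i) = ⊤

  Contrs : ∀ {n} → List (Ty n) → Set
  Contrs [] = ⊤
  Contrs (T ∷ Ts) = Contr T × Contrs Ts

ext : ∀ {n m} → (Fin n → Fin m) → Fin (suc n) → Fin (suc m)
ext ρ zero = zero
ext ρ (suc i) = suc (ρ i)

mutual
  tren : ∀ {n m} → (Fin n → Fin m) → Ty n → Ty m
  tren ρ (chan a Ts) = chan a (trens ρ Ts)
  tren ρ (μ U) = μ (tren (ext ρ) U)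
  tren ρ (tv i) = tv (ρ i)

  trens : ∀ {n m} → (Fin n → Fin m) → List (Ty n) → List (Ty m)
  trens ρ [] = []
  trens ρ (T ∷ Ts) = tren ρ T ∷ trens ρ Ts

exts : ∀ {n m} → (Fin n → Ty m) → Fin (suc n) → Ty (suc m)
exts σ zero = tv zero
exts σ (suc i) = tren suc (σ i)

mutual
  tsub : ∀ {n m} → (Fin n → Ty m) → Ty n → Ty m
  tsub σ (chan a Ts) = chan a (tsubs σ Ts)
  tsub σ (μ U) = μ (tsub (exts σ) U)
  tsub σ (tv i) = σ i

  tsubs : ∀ {n m} → (Fin n → Ty m) → List (Ty n) → List (Ty m)
  tsubs σ [] = []
  tsubs σ (T ∷ Ts) = tsub σ T ∷ tsubs σ Ts

sub0 : ∀ {n} → Ty (suc n) → Ty n → Ty n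
sub0 {n} U V = tsub σ U
  where
  σ : Fin (suc n) → Ty n
  σ zero = V
  σ (suc i) = tv i

unfold : Ty 1 → Ty 0
unfold U = sub0 U (μ U)

NotMu : Ty 0 → Set
NotMu (μ U) = ⊥
NotMu _ = ⊤

-- equi-recursive type equality: greatest fixed point (exists a
-- post-fixed point / type bisimulation containing the pair)
data TyStep (R : Ty 0 → Ty 0 → Set) : Ty 0 → Ty 0 → Set where
  μl : ∀ {U T} → R (unfold U) T → TyStep R (μ U) T
  μr : ∀ {S U} → NotMu S → R S (unfold U) → TyStep R S (μ U)
  ch : ∀ {a Ss Ts} → Pointwise R Ss Ts → TyStep R (chan a Ss) (chan a Ts)

_~ᵤ_ : Ty 0 → Ty 0 → Set₁
S ~ᵤ T = Σ (Ty 0 → Ty 0 → Set) λ R →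
           (∀ {S' T'} → R S' T' → TyStep R S' T') × R S T

data Type : Set where
  ut   : Ty 0 → Type
  proc : Type

data _~_ : Type → Type → Set₁ where
  proc~ : proc ~ proc
  ut~   : ∀ {S T} → S ~ᵤ T → ut S ~ ut T

ContrT : Type → Set
ContrT (ut T) = Contr T
ContrT proc = ⊤

-- Type environments (finite multisets, as lists up to permutation)

Env : Set
Env = List (Id × Type)

dom : Env → List Id
dom Γ = map proj₁ Γ

EnvContr : Env → Set
EnvContr Γ = All (λ e → ContrT (proj₂ e)) Γ

zipA : List Id → List (Ty 0) → Env
zipA = zipWith (λ u T → u , ut T)

cht : Attr → List (Ty 0) → Type
cht a Ts = ut (chan a Ts)

data Split : Type → Type → Type → Set where
  spω    : ∀ {Ts} → Split (cht ω Ts) (cht ω Ts) (cht ω Ts)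
  spproc : Split proc proc proc
  sp•    : ∀ {Ts i} → Split (cht (• i) Ts) (cht one Ts) (cht (• suc i) Ts)

data _⪯_ : Attr → Attr → Set where
  ⪯-refl  : ∀ {a} → a ⪯ a
  ⪯-trans : ∀ {a b c} → a ⪯ b → b ⪯ c → a ⪯ c
  ••      : ∀ {i} → (• i) ⪯ (• suc i)
  •ω      : ∀ {i} → (• i) ⪯ ω
  ω1      : ω ⪯ one

data _≺_ : Env → Env → Set₁ where
  ≺-refl  : ∀ {Γ} → Γ ≺ Γ
  ≺-trans : ∀ {Γ Δ Θ} → Γ ≺ Δ → Δ ≺ Θ → Γ ≺ Θ
  ≺-perm  : ∀ {Γ Δ} → Γ ↭ Δ → Γ ≺ Δ
  ≺-split : ∀ {Γ u T T₁ T₂} → Split T T₁ T₂ →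
            ((u , T) ∷ Γ) ≺ ((u , T₁) ∷ (u , T₂) ∷ Γ)
  ≺-join  : ∀ {Γ u T T₁ T₂} → Split T T₁ T₂ →
            ((u , T₁) ∷ (u , T₂) ∷ Γ) ≺ ((u , T) ∷ Γ)
  ≺-eq    : ∀ {Γ u T₁ T₂} → T₁ ~ T₂ → ContrT T₂ →
            ((u , T₁) ∷ Γ) ≺ ((u , T₂) ∷ Γ)
  ≺-sub   : ∀ {Γ u a₁ a₂ Ts} → a₁ ⪯ a₂ →
            ((u , cht a₁ Ts) ∷ Γ) ≺ ((u , cht a₂ Ts) ∷ Γ)
  ≺-weak  : ∀ {Γ u T} → ((u , T) ∷ Γ) ≺ Γ
  ≺-•     : ∀ {Γ u Ts₁ Ts₂} → Contrs Ts₂ →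
            ((u , cht (• 0) Ts₁) ∷ Γ) ≺ ((u , cht (• 0) Ts₂) ∷ Γ)

data _≈ₑ_ : Env → Env → Set₁ where
  ≈-perm  : ∀ {Γ Δ} → Γ ↭ Δ → Γ ≈ₑ Δ
  ≈-ty    : ∀ {Γ u T₁ T₂} → T₁ ~ T₂ → ((u , T₁) ∷ Γ) ≈ₑ ((u , T₂) ∷ Γ)
  ≈-sym   : ∀ {Γ Δ} → Γ ≈ₑ Δ → Δ ≈ₑ Γ
  ≈-trans : ∀ {Γ Δ Θ} → Γ ≈ₑ Δ → Δ ≈ₑ Θ → Γ ≈ₑ Θ

data Decr : Id → Attr → List (Ty 0) → Env → Set where
  dec1 : ∀ {u Ts} → Decr u one Ts []
  decω : ∀ {u Ts} → Decr u ω Ts ((u , cht ω Ts) ∷ [])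
  dec• : ∀ {u Ts i} → Decr u (• suc i) Ts ((u , cht (• i) Ts) ∷ [])

data Unr : Id × Type → Set where
  unrω    : ∀ {u Ts} → Unr (u , cht ω Ts)
  unrproc : ∀ {u} → Unr (u , proc)

infix 4 _⊢_
data _⊢_ : Env → Proc → Set₁ where
  t-out   : ∀ {Γ Δ u a Ts vs P} → Decr u a Ts Δ → length vs ≡ length Ts →
            Δ ++ Γ ⊢ P →
            (u , cht a Ts) ∷ (zipA vs Ts ++ Γ) ⊢ out u vs P
  t-inp   : ∀ {Γ Δ u a Ts xs P} → Decr u a Ts Δ → length xs ≡ length Ts →
            Δ ++ (zipA (map vr xs) Ts ++ Γ) ⊢ P →
            (u , cht a Ts) ∷ Γ ⊢ inp u xs P
  t-par   : ∀ {Γ₁ Γ₂ P Q} → Γ₁ ⊢ P → Γ₂ ⊢ Q → Γ₁ ++ Γ₂ ⊢ par P Q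
  t-if    : ∀ {Γ u v P Q} → u ∈ dom Γ → v ∈ dom Γ → Γ ⊢ P → Γ ⊢ Q →
            Γ ⊢ ite u v P Q
  t-rec   : ∀ {Γ w P} → All Unr Γ → (vr w , proc) ∷ Γ ⊢ P → Γ ⊢ rec w P
  t-var   : ∀ {w} → (vr w , proc) ∷ [] ⊢ pvar w
  t-free  : ∀ {Γ u Ts P} → Γ ⊢ P → (u , cht (• 0) Ts) ∷ Γ ⊢ free u P
  t-alloc : ∀ {Γ x Ts P} → Contrs Ts → (vr x , cht (• 0) Ts) ∷ Γ ⊢ P →
            Γ ⊢ alloc x P
  t-nil   : [] ⊢ nil
  t-sub   : ∀ {Γ Γ' P} → Γ ≺ Γ' → Γ' ⊢ P → Γ ⊢ P

Consistent : Env → Set₁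
Consistent Γ = Σ Env λ Γ' → Unique (dom Γ') × (Γ' ≺ Γ)

DomIn : Env → ResEnv → Set
DomIn Γ M = All (λ e → Σ Chan λ c → proj₁ e ≡ ch c × M c) Γ

SysTyped : Env → Sys → Set₁
SysTyped Δ (M ▷ P) = (Δ ⊢ P) × DomIn Δ M × Consistent Δ × EnvContr Δ

Config : Env → Sys → Set₁
Config Γ (M ▷ P) = EnvContr Γ × InfUnalloc M × DomIn Γ M ×
  Σ Env λ Δ → Consistent (Γ ++ Δ) × SysTyped Δ (M ▷ P)

data Label : Set where
  outL   : Chan → List Chan → Label
  inL    : Chan → List Chan → Label
  τ      : Label
  allocL : Label
  freeL  : Chan → Label
  envL   : Label

-1ℤ : ℤ
-1ℤ = ℤ.- (+ 1)

-- pre-transitions  Γ ◁ M ▷ P  --μ-->pre_k  Γ' ◁ M' ▷ P'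
-- (environments are taken up to ≈ₑ, i.e. multisets with types up to ~)
data Pre : Env → ResEnv → Proc → Label → ℤ → Env → ResEnv → Proc → Set₁ where
  p-out   : ∀ {Γ₀ Γ Γ₁ Δ M c a Ts ds P} →
            Γ₀ ≈ₑ ((ch c , cht a Ts) ∷ Γ) → Decr (ch c) a Ts Δ →
            length ds ≡ length Ts →
            Γ₁ ≈ₑ (Δ ++ (zipA (map ch ds) Ts ++ Γ)) →
            Pre Γ₀ M (out (ch c) (map ch ds) P) (outL c ds) (+ 0) Γ₁ M P
  p-inp   : ∀ {Γ₀ Γ Γ₁ Δ M c a Ts ds xs P} →
            Γ₀ ≈ₑ ((ch c , cht a Ts) ∷ (zipA (map ch ds) Ts ++ Γ)) →
            Decr (ch c) a Ts Δ →
            length ds ≡ length Ts → length xs ≡ length ds →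
            Γ₁ ≈ₑ (Δ ++ Γ) →
            Pre Γ₀ M (inp (ch c) xs P) (inL c ds) (+ 0) Γ₁ M (subP (zip xs ds) P)
  p-comml : ∀ {Γ Γ₁ Γ₁' Γ₂ Γ₂' M c ds P P' Q Q'} →
            Pre Γ₁ M P (outL c ds) (+ 0) Γ₁' M P' →
            Pre Γ₂ M Q (inL c ds) (+ 0) Γ₂' M Q' →
            Pre Γ M (par P Q) τ (+ 0) Γ M (par P' Q')
  p-commr : ∀ {Γ Γ₁ Γ₁' Γ₂ Γ₂' M c ds P P' Q Q'} →
            Pre Γ₁ M P (outL c ds) (+ 0) Γ₁' M P' →
            Pre Γ₂ M Q (inL c ds) (+ 0) Γ₂' M Q' →
            Pre Γ M (par Q P) τ (+ 0) Γ M (par Q' P')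
  p-parl  : ∀ {Γ Γ' M M' P P' Q μ' k} →
            Pre Γ M P μ' k Γ' M' P' →
            Pre Γ M (par P Q) μ' k Γ' M' (par P' Q)
  p-parr  : ∀ {Γ Γ' M M' P P' Q μ' k} →
            Pre Γ M P μ' k Γ' M' P' →
            Pre Γ M (par Q P) μ' k Γ' M' (par Q P')
  p-env   : ∀ {Γ Γ' M P} → Γ ≺ Γ' → Pre Γ M P envL (+ 0) Γ' M P
  p-rec   : ∀ {Γ M w P} → Pre Γ M (rec w P) τ (+ 0) Γ M (psub w (rec w P) P)
  p-ift   : ∀ {Γ M c P Q} → M c →
            Pre Γ M (ite (ch c) (ch c) P Q) τ (+ 0) Γ M P
  p-iff   : ∀ {Γ M c d P Q} → c ≢ d → M c → M d →
            Pre Γ M (ite (ch c) (ch d) P Q) τ (+ 0) Γ M Q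
  p-alloc : ∀ {Γ M c x P} → ¬ M c →
            Pre Γ M (alloc x P) τ (+ 1) Γ (M ,ₘ c) (subP ((x , c) ∷ []) P)
  p-allocL : ∀ {Γ Γ₁ M c Ts P} → ¬ M c → Contrs Ts →
            Γ₁ ≈ₑ ((ch c , cht (• 0) Ts) ∷ Γ) →
            Pre Γ M P allocL (+ 1) Γ₁ (M ,ₘ c) P
  p-free  : ∀ {Γ M c P} → M c →
            Pre Γ M (free (ch c) P) τ -1ℤ Γ (M ∖ₘ c) P
  p-freeL : ∀ {Γ₀ Γ Γ₁ M c Ts P} →
            Γ₀ ≈ₑ ((ch c , cht (• 0) Ts) ∷ Γ) → M c → Γ₁ ≈ₑ Γ →
            Pre Γ₀ M P (freeL c) -1ℤ Γ₁ (M ∖ₘ c) P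

Fixes : (Chan ↔ Chan) → Env → Set
Fixes σ Γ = ∀ c → ch c ∈ dom Γ → Inverse.to σ c ≡ c

renSys : (Chan ↔ Chan) → Sys → Sys
renSys σ (M ▷ P) = (λ d → M (Inverse.from σ d)) ▷ renP (Inverse.to σ) P

Trans : Env → Sys → Label → ℤ → Env → Sys → Set₁
Trans Γ S μ' k Γ' (M' ▷ P') =
  Σ (Chan ↔ Chan) λ σ → Fixes σ Γ ×
    Pre Γ (Sys.res (renSys σ S)) (Sys.proc (renSys σ S)) μ' k Γ' M' P'

data TauStar : Env → Sys → ℤ → Env → Sys → Set₁ where
  τ-none : ∀ {Γ S} → TauStar Γ S (+ 0) Γ S
  τ-step : ∀ {Γ Γ₁ Γ₂ S S₁ S₂ k₁ k₂} → Trans Γ S τ k₁ Γ₁ S₁ →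
           TauStar Γ₁ S₁ k₂ Γ₂ S₂ → TauStar Γ S (k₁ ℤ.+ k₂) Γ₂ S₂

data Weak : Env → Sys → Label → ℤ → Env → Sys → Set₁ where
  weak : ∀ {Γ Γ₁ Γ₂ Γ₃ S S₁ S₂ S₃ μ' k₁ k₂ k₃} →
         TauStar Γ S k₁ Γ₁ S₁ → Trans Γ₁ S₁ μ' k₂ Γ₂ S₂ →
         TauStar Γ₂ S₂ k₃ Γ₃ S₃ → Weak Γ S μ' (k₁ ℤ.+ k₂ ℤ.+ k₃) Γ₃ S₃

WeakHat : Env → Sys → Label → ℤ → Env → Sys → Set₁
WeakHat Γ S τ k Γ' S' = TauStar Γ S k Γ' S'
WeakHat Γ S μ' k Γ' S' = Weak Γ S μ' k Γ' S'

-- an amortised relation: R Γ n S T  stands for  Γ ⊨ S R^n T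
ARel : Set₂
ARel = Env → ℕ → Sys → Sys → Set₁

IsTyped : ARel → Set₁
IsTyped R = ∀ {Γ n S T} → R Γ n S T → Config Γ S × Config Γ T

IsAmortisedBisim : ARel → Set₁
IsAmortisedBisim R = ∀ {Γ n S T} → R Γ n S T →
  (∀ {μ' k Γ' S'} → Trans Γ S μ' k Γ' S' →
     Σ ℤ λ l → Σ Sys λ T' → Σ ℕ λ n' →
       WeakHat Γ T μ' l Γ' T' × ((+ n') ≡ (+ n) ℤ.+ l ℤ.- k) × R Γ' n' S' T')
  × (∀ {μ' l Γ' T'} → Trans Γ T μ' l Γ' T' →
     Σ ℤ λ k → Σ Sys λ S' → Σ ℕ λ n' →
       WeakHat Γ S μ' k Γ' S' × ((+ n') ≡ (+ n) ℤ.+ l ℤ.- k) × R Γ' n' S' T')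

BoundedBisim : ℕ → Env → Sys → Sys → Set₂
BoundedBisim m Γ S T = Σ ARel λ R →
  IsTyped R × IsAmortisedBisim R ×
  (∀ {Γ' n S' T'} → R Γ' n S' T' → n ≤ m) ×
  Σ ℕ λ n → R Γ n S T

module Submission where

open import Defs
open import Data.Nat as ℕ using (ℕ; _∸_)
import Data.Nat.Properties as ℕ
open import Data.Integer as ℤ using (ℤ; +_)
import Data.Integer.Properties as ℤ
open import Data.Integer.Solver using (module +-*-Solver)
open import Data.Product using (Σ; _×_; _,_; proj₁; proj₂)
open import Relation.Binary.PropositionalEquality

-- Swap the two systems and replace every credit n by m ∸ n. When one side
-- moves at cost k and the other answers at cost l, the credit n becomes
-- n + l − k, so its complement m − n becomes (m − n) + k − l: precisely the
-- update the converse relation demands, with the roles of k and l swapped.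
-- The bound m is what keeps the complemented credits in ℕ.

CreditsBoundedBy : ℕ → ARel → Set₁
CreditsBoundedBy m R = ∀ {Γ n S T} → R Γ n S T → n ℕ.≤ m

complementedConverse : ℕ → ARel → ARel
complementedConverse m R Γ n T S = Σ ℕ λ n′ → R Γ n′ S T × n ℕ.+ n′ ≡ m

complement-credit-update : ∀ {m n n′ n₁} (a b : ℤ) → n₁ ℕ.≤ m → n ℕ.+ n′ ≡ m →
  + n₁ ≡ + n′ ℤ.+ a ℤ.- b → + (m ∸ n₁) ≡ + n ℤ.+ b ℤ.- a
complement-credit-update {m} {n} {n′} {n₁} a b n₁≤m n+n′≡m n₁≡n′+a-b = begin
  + (m ∸ n₁)                            ≡⟨ ℤ.≤-⊖ n₁≤m ⟨
  m ℤ.⊖ n₁                              ≡⟨ ℤ.m-n≡m⊖n m n₁ ⟨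
  + m ℤ.- + n₁                          ≡⟨ cong₂ ℤ._-_ (cong +_ (sym n+n′≡m)) n₁≡n′+a-b ⟩
  + (n ℕ.+ n′) ℤ.- (+ n′ ℤ.+ a ℤ.- b)   ≡⟨ cong (ℤ._- (+ n′ ℤ.+ a ℤ.- b)) (ℤ.pos-+ n n′) ⟩
  (+ n ℤ.+ + n′) ℤ.- (+ n′ ℤ.+ a ℤ.- b) ≡⟨ cancel (+ n) (+ n′) a b ⟩
  + n ℤ.+ b ℤ.- a                       ∎
  where
  open ≡-Reasoning
  open +-*-Solver
  cancel : ∀ p q a b → (p ℤ.+ q) ℤ.- (q ℤ.+ a ℤ.- b) ≡ p ℤ.+ b ℤ.- a
  cancel = solve 4 (λ p q a b → (p :+ q) :- (q :+ a :- b) := p :+ b :- a) refl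

module _ {m : ℕ} (R : ARel) where

  complementedConverse-∋ : ∀ {Γ n S T} → n ℕ.≤ m → R Γ n S T →
    complementedConverse m R Γ (m ∸ n) T S
  complementedConverse-∋ {n = n} n≤m r = n , r , ℕ.m∸n+n≡m n≤m

  complementedConverse-typed : IsTyped R → IsTyped (complementedConverse m R)
  complementedConverse-typed typed (_ , r , _) with typed r
  ... | configS , configT = configT , configS

  complementedConverse-bounded : CreditsBoundedBy m (complementedConverse m R)
  complementedConverse-bounded {n = n} (n′ , _ , n+n′≡m) =
    subst (n ℕ.≤_) n+n′≡m (ℕ.m≤m+n n n′)

  complementedConverse-bisim : CreditsBoundedBy m R → IsAmortisedBisim R →
    IsAmortisedBisim (complementedConverse m R)
  complementedConverse-bisim bounded bisim {Γ} {n} {T} {S} (n′ , r , n+n′≡m) =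
    matchMoveOfT , matchMoveOfS
    where
    matchMoveOfT : ∀ {μ k Γ′ T′} → Trans Γ T μ k Γ′ T′ →
      Σ ℤ λ l → Σ Sys λ S′ → Σ ℕ λ n₁ → WeakHat Γ S μ l Γ′ S′ ×
        (+ n₁ ≡ + n ℤ.+ l ℤ.- k) × complementedConverse m R Γ′ n₁ T′ S′
    matchMoveOfT step with proj₂ (bisim r) step
    ... | l , S′ , n₁ , weakS , credit , r₁ =
      l , S′ , m ∸ n₁ , weakS ,
      complement-credit-update _ l (bounded r₁) n+n′≡m credit ,
      complementedConverse-∋ (bounded r₁) r₁

    matchMoveOfS : ∀ {μ l Γ′ S′} → Trans Γ S μ l Γ′ S′ →
      Σ ℤ λ k → Σ Sys λ T′ → Σ ℕ λ n₁ → WeakHat Γ T μ k Γ′ T′ ×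
        (+ n₁ ≡ + n ℤ.+ l ℤ.- k) × complementedConverse m R Γ′ n₁ T′ S′
    matchMoveOfS step with proj₁ (bisim r) step
    ... | k , T′ , n₁ , weakT , credit , r₁ =
      k , T′ , m ∸ n₁ , weakT ,
      complement-credit-update k _ (bounded r₁) n+n′≡m credit ,
      complementedConverse-∋ (bounded r₁) r₁

lemma4p14 : (m : ℕ) (Γ : Env) (M N : ResEnv) (P Q : Proc) →
    BoundedBisim m Γ (M ▷ P) (N ▷ Q) → BoundedBisim m Γ (N ▷ Q) (M ▷ P)
lemma4p14 m Γ M N P Q (R , typed , bisim , bounded , n , r) =
  complementedConverse m R ,
  complementedConverse-typed R typed ,
  complementedConverse-bisim R bounded bisim ,
  complementedConverse-bounded R ,
  m ∸ n , complementedConverse-∋ R (bounded r) r
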